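{- For all unrestricted $\lambda_\epsilon$-terms $s,v$ and every variable $x$: if $s\Rightarrow\lambda x.v$, then the full parallel reduct $s_\downarrow$ is of the form $\lambda x.w$ for some term $w$.
   Context: Unrestricted terms of the $\lambda_\epsilon$-calculus are generated by $t ::= x \mid \lambda x.t \mid (s\ t) \mid \mathsf{D}(s)\cdot t \mid \epsilon t \mid s+t \mid 0$, over a countably infinite set of variables, up to $\alpha$-equivalence. $t[s/x]$ is capture-avoiding substitution. Differential substitution $\frac{\partial t}{\partial x}(s)$ (for $x$ not free in $s$): $\frac{\partial x}{\partial x}(s)=s$; $\frac{\partial y}{\partial x}(s)=0$ ($y\ne x$); $\frac{\partial(\lambda y.t)}{\partial x}(s)=\lambda y.\frac{\partial t}{\partial x}(s)$; $\frac{\partial(t\ e)}{\partial x}(s)=\big((\mathsf{D}(t)\cdot\frac{\partial e}{\partial x}(s))\ e\big)+\big(\frac{\partial t}{\partial x}(s)\ (e[x+\epsilon s/x])\big)$; $\frac{\partial(\mathsf{D}(t)\cdot e)}{\partial x}(s)=\mathsf{D}(t)\cdot\frac{\partial e}{\partial x}(s)+\mathsf{D}(\frac{\partial t}{\partial x}(s))\cdot(e[x+\epsilon s/x])+\epsilon\big(\mathsf{D}(\mathsf{D}(t)\cdot e)\cdot\frac{\partial e}{\partial x}(s)\big)$; $\frac{\partial(\epsilon t)}{\partial x}(s)=\epsilon\frac{\partial t}{\partial x}(s)$; $\frac{\partial(t+e)}{\partial x}(s)=\frac{\partial t}{\partial x}(s)+\frac{\partial e}{\partial x}(s)$; $\frac{\partial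 0}{\partial x}(s)=0$. Parallel reduction $\Rightarrow$ is the least relation closed under: $x\Rightarrow x$; $0\Rightarrow 0$; if $t\Rightarrow t'$ then $\lambda x.t\Rightarrow\lambda x.t'$ and $\epsilon t\Rightarrow\epsilon t'$; if $s\Rightarrow s'$, $t\Rightarrow t'$ then $s+t\Rightarrow s'+t'$, $(s\ t)\Rightarrow(s'\ t')$, $\mathsf{D}(s)\cdot t\Rightarrow\mathsf{D}(s')\cdot t'$; if $s\Rightarrow\lambda x.s'$ and $t\Rightarrow t'$ then $(s\ t)\Rightarrow s'[t'/x]$ and $\mathsf{D}(s)\cdot t\Rightarrow\lambda x.\frac{\partial s'}{\partial x}(t')$. The full parallel reduct $t_\downarrow$ is defined by: $x_\downarrow=x$, $(\epsilon t)_\downarrow=\epsilon(t_\downarrow)$, $(s+t)_\downarrow=s_\downarrow+t_\downarrow$, $0_\downarrow=0$, $(\lambda x.t)_\downarrow=\lambda x.(t_\downarrow)$; $(s\ t)_\downarrow=e[t_\downarrow/x]$ if $s_\downarrow=\lambda x.e$, and $(s_\downarrow\ t_\downarrow)$ otherwise; $(\mathsf{D}(s)\cdot t)_\downarrow=\lambda x.\frac{\partial e}{\partial x}(t_\downarrow)$ if $s_\downarrow=\lambda x.e$, and $\mathsf{D}(s_\downarrow)\cdot t_\downarrow$ otherwise. -}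

module Defs where

open import Data.Nat using (ℕ; zero; suc; _≟_)
open import Relation.Nullary using (yes; no)

-- Unrestricted λε-terms, up to α-equivalence, represented with de Bruijn indices.
infixl 6 _⊕_
data Tm : Set where
  var  : ℕ → Tm
  lam  : Tm → Tm
  app  : Tm → Tm → Tm
  D    : Tm → Tm → Tm          -- D(s)·t
  eps  : Tm → Tm
  _⊕_  : Tm → Tm → Tm
  zer  : Tm

ext : (ℕ → ℕ) → ℕ → ℕ
ext ρ zero    = zero
ext ρ (suc n) = suc (ρ n)

ren : (ℕ → ℕ) → Tm → Tm
ren ρ (var n)   = var (ρ n)
ren ρ (lam t)   = lam (ren (ext ρ) t)
ren ρ (app s t) = app (ren ρ s) (ren ρ t)
ren ρ (D s t)   = D (ren ρ s) (ren ρ t)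
ren ρ (eps t)   = eps (ren ρ t)
ren ρ (s ⊕ t)   = ren ρ s ⊕ ren ρ t
ren ρ zer       = zer

exts : (ℕ → Tm) → ℕ → Tm
exts σ zero    = var zero
exts σ (suc n) = ren suc (σ n)

sub : (ℕ → Tm) → Tm → Tm
sub σ (var n)   = σ n
sub σ (lam t)   = lam (sub (exts σ) t)
sub σ (app s t) = app (sub σ s) (sub σ t)
sub σ (D s t)   = D (sub σ s) (sub σ t)
sub σ (eps t)   = eps (sub σ t)
sub σ (s ⊕ t)   = sub σ s ⊕ sub σ t
sub σ zer       = zer

_[_/0] : Tm → Tm → Tm
t [ u /0] = sub σ t
  where
  σ : ℕ → Tm
  σ zero    = u
  σ (suc n) = var n

-- t[x + ε s / x] for the variable with index i (the variable stays in scope)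
plusEps : ℕ → Tm → ℕ → Tm
plusEps i s j with j ≟ i
... | yes _ = var i ⊕ eps s
... | no  _ = var j

-- Differential substitution ∂t/∂x(s), x = variable with index i,
-- s a term in the same scope as t (x not free in s).
∂ : ℕ → Tm → Tm → Tm
∂ i (var j) s with j ≟ i
... | yes _ = s
... | no  _ = zer
∂ i (lam t) s   = lam (∂ (suc i) t (ren suc s))
∂ i (app t e) s =
  app (D t (∂ i e s)) e ⊕ app (∂ i t s) (sub (plusEps i s) e)
∂ i (D t e) s   =
  D t (∂ i e s) ⊕ D (∂ i t s) (sub (plusEps i s) e) ⊕ eps (D (D t e) (∂ i e s))
∂ i (eps t) s   = eps (∂ i t s)
∂ i (t ⊕ e) s   = ∂ i t s ⊕ ∂ i e s
∂ i zer s       = zer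

-- λx. ∂s'/∂x(t'), with t' living outside the binder
dlam : Tm → Tm → Tm
dlam s' t' = lam (∂ zero s' (ren suc t'))

infix 4 _⇒_
data _⇒_ : Tm → Tm → Set where
  ⇒var  : ∀ {n} → var n ⇒ var n
  ⇒zer  : zer ⇒ zer
  ⇒lam  : ∀ {t t'} → t ⇒ t' → lam t ⇒ lam t'
  ⇒eps  : ∀ {t t'} → t ⇒ t' → eps t ⇒ eps t'
  ⇒sum  : ∀ {s s' t t'} → s ⇒ s' → t ⇒ t' → s ⊕ t ⇒ s' ⊕ t'
  ⇒app  : ∀ {s s' t t'} → s ⇒ s' → t ⇒ t' → app s t ⇒ app s' t'
  ⇒D    : ∀ {s s' t t'} → s ⇒ s' → t ⇒ t' → D s t ⇒ D s' t'
  ⇒β    : ∀ {s s' t t'} → s ⇒ lam s' → t ⇒ t' → app s t ⇒ s' [ t' /0]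
  ⇒Dβ   : ∀ {s s' t t'} → s ⇒ lam s' → t ⇒ t' → D s t ⇒ dlam s' t'

appR : Tm → Tm → Tm
appR (lam e) u = e [ u /0]
appR s       u = app s u

DR : Tm → Tm → Tm
DR (lam e) u = dlam e u
DR s       u = D s u

_↓ : Tm → Tm
var n ↓   = var n
lam t ↓   = lam (t ↓)
app s t ↓ = appR (s ↓) (t ↓)
D s t ↓   = DR (s ↓) (t ↓)
eps t ↓   = eps (t ↓)
(s ⊕ t) ↓ = (s ↓) ⊕ (t ↓)
zer ↓     = zer

-- Say that w agrees with u on its λ-spine if w has the same λ-prefix as u and,
-- when that prefix ends in a variable, the same variable. Whenever s ⇒ u, the
-- full reduct s ↓ agrees with u on its λ-spine: the spine is preserved by
-- renaming, substitution and differential substitution, which is all the β- and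
-- Dβ-cases need. Tracking variables, not just λs, is essential: in a β-step whose
-- body is the bound variable, the λ of the result comes from the argument.
module Submission where

open import Defs
open import Data.Nat using (zero; suc; _≟_)
open import Data.Product using (∃; Σ-syntax; _,_; _×_)
open import Data.Unit using (⊤; tt)
open import Relation.Nullary using (yes; no)
open import Relation.Binary.PropositionalEquality using (_≡_; refl)

LamSpine : Tm → Tm → Set
LamSpine (var i) w = w ≡ var i
LamSpine (lam u) w = Σ[ w′ ∈ Tm ] w ≡ lam w′ × LamSpine u w′
LamSpine _       _ = ⊤

LamSpine-ren : ∀ ρ u w → LamSpine u w → LamSpine (ren ρ u) (ren ρ w)
LamSpine-ren ρ (var i) _ refl              = refl
LamSpine-ren ρ (lam u) _ (w , refl , spine) =
  ren (ext ρ) w , refl , LamSpine-ren (ext ρ) u w spine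
LamSpine-ren ρ (app _ _) _ _ = tt
LamSpine-ren ρ (D _ _)   _ _ = tt
LamSpine-ren ρ (eps _)   _ _ = tt
LamSpine-ren ρ (_ ⊕ _)   _ _ = tt
LamSpine-ren ρ zer       _ _ = tt

LamSpine-exts : ∀ σ τ → (∀ n → LamSpine (σ n) (τ n)) →
                ∀ n → LamSpine (exts σ n) (exts τ n)
LamSpine-exts σ τ spines zero    = refl
LamSpine-exts σ τ spines (suc n) = LamSpine-ren suc (σ n) (τ n) (spines n)

LamSpine-sub : ∀ σ τ → (∀ n → LamSpine (σ n) (τ n)) →
               ∀ u w → LamSpine u w → LamSpine (sub σ u) (sub τ w)
LamSpine-sub σ τ spines (var i) _ refl              = spines i
LamSpine-sub σ τ spines (lam u) _ (w , refl , spine) =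
  sub (exts τ) w , refl ,
  LamSpine-sub (exts σ) (exts τ) (LamSpine-exts σ τ spines) u w spine
LamSpine-sub σ τ spines (app _ _) _ _ = tt
LamSpine-sub σ τ spines (D _ _)   _ _ = tt
LamSpine-sub σ τ spines (eps _)   _ _ = tt
LamSpine-sub σ τ spines (_ ⊕ _)   _ _ = tt
LamSpine-sub σ τ spines zer       _ _ = tt

LamSpine-[/0] : ∀ u w t r → LamSpine u w → LamSpine t r →
                LamSpine (u [ t /0]) (w [ r /0])
LamSpine-[/0] u w t r spine spineₜ =
  LamSpine-sub (λ n → var n [ t /0]) (λ n → var n [ r /0]) spines u w spine
  where
  spines : ∀ n → LamSpine (var n [ t /0]) (var n [ r /0])
  spines zero    = spineₜ
  spines (suc n) = refl

LamSpine-∂ : ∀ i u w t r → LamSpine u w → LamSpine t r →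
             LamSpine (∂ i u t) (∂ i w r)
LamSpine-∂ i (var j) _ t r refl spineₜ with j ≟ i
... | yes _ = spineₜ
... | no  _ = tt
LamSpine-∂ i (lam u) _ t r (w , refl , spine) spineₜ =
  ∂ (suc i) w (ren suc r) , refl ,
  LamSpine-∂ (suc i) u w (ren suc t) (ren suc r) spine (LamSpine-ren suc t r spineₜ)
LamSpine-∂ i (app _ _) _ _ _ _ _ = tt
LamSpine-∂ i (D _ _)   _ _ _ _ _ = tt
LamSpine-∂ i (eps _)   _ _ _ _ _ = tt
LamSpine-∂ i (_ ⊕ _)   _ _ _ _ _ = tt
LamSpine-∂ i zer       _ _ _ _ _ = tt

⇒-LamSpine-↓ : ∀ {s u} → s ⇒ u → LamSpine u (s ↓)
⇒-LamSpine-↓ ⇒var              = refl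
⇒-LamSpine-↓ ⇒zer              = tt
⇒-LamSpine-↓ (⇒lam {t} t⇒)     = t ↓ , refl , ⇒-LamSpine-↓ t⇒
⇒-LamSpine-↓ (⇒eps _)          = tt
⇒-LamSpine-↓ (⇒sum _ _)        = tt
⇒-LamSpine-↓ (⇒app _ _)        = tt
⇒-LamSpine-↓ (⇒D _ _)          = tt
⇒-LamSpine-↓ (⇒β {s} {s′} {t} {t′} s⇒ t⇒) with s ↓ | ⇒-LamSpine-↓ s⇒
... | .(lam w) | w , refl , spine =
  LamSpine-[/0] s′ w t′ (t ↓) spine (⇒-LamSpine-↓ t⇒)
⇒-LamSpine-↓ (⇒Dβ {s} {s′} {t} {t′} s⇒ t⇒) with s ↓ | ⇒-LamSpine-↓ s⇒
... | .(lam w) | w , refl , spine =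
  ∂ zero w (ren suc (t ↓)) , refl ,
  LamSpine-∂ zero s′ w (ren suc t′) (ren suc (t ↓)) spine
    (LamSpine-ren suc t′ (t ↓) (⇒-LamSpine-↓ t⇒))

mainTheorem6 : ∀ (s v : Tm) → s ⇒ lam v → ∃ λ w → s ↓ ≡ lam w
mainTheorem6 s v s⇒λv with ⇒-LamSpine-↓ s⇒λv
... | w , s↓≡λw , _ = w , s↓≡λw
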